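{- Let $G$ be a graph and $L$ an $m$-assignment for $G$. Suppose $uv\in E(G)$, $|L(u)\setminus L(v)|=d\ge 1$, and that for all $x\in L(u)$ and $y\in L(v)$ with $x\ne y$ there are at least $C$ proper $L$-colorings of $G$ that color $u$ with $x$ and $v$ with $y$. Then $P(G,L)\ge P_{DP}(G,m)+Cd$.
   Context: An $m$-assignment $L$ gives each vertex a set of $m$ colors; a proper $L$-coloring is a proper coloring $f$ with $f(w)\in L(w)$ for all $w$, and $P(G,L)$ is their number. A DP-cover of $G$ is a pair $\mathcal{H}=(L,H)$ where $H$ is a graph and $L$ maps each vertex of $G$ to a subset of $V(H)$ such that $\{L(v):v\in V(G)\}$ partitions $V(H)$ into $|V(G)|$ parts, for each edge $uv\in E(G)$ the edges of $H$ between $L(u)$ and $L(v)$ form a matching (possibly empty, not necessarily perfect), and every edge of $H$ lies between $L(u)$ and $L(v)$ for some $uv\in E(G)$. It is $m$-fold if $|L(v)|=m$ for all $v$. A proper $\mathcal{H}$-coloring is an independent set of $H$ containing exactly one vertex of each $L(v)$. $P_{DP}(G,m)$ is the minimum, over all $m$-fold covers $\mathcal{H}$ of $G$, of the number of proper $\mathcal{H}$-colorings. -}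

module Defs where

open import Data.Nat using (ℕ; zero; suc; _+_)
open import Data.Bool using (Bool; true; false; if_then_else_)
open import Data.Fin using (Fin; zero; suc)
open import Data.Fin.Properties using (all?)
import Data.Nat as ℕ
import Data.Fin as F
open import Data.Vec.Functional using (_∷_)
open import Relation.Binary.PropositionalEquality using (_≡_; _≢_)
open import Relation.Nullary using (Dec; does; ¬_)
open import Relation.Nullary.Decidable using (¬?; _→-dec_; _×-dec_)
open import Data.Product using (_×_)
open import Function.Definitions using (Injective)

countFin : (k : ℕ) (P : Fin k → Set) → (∀ i → Dec (P i)) → ℕ
countFin zero    P P? = 0
countFin (suc k) P P? =
  (if does (P? zero) then 1 else 0) + countFin k (λ i → P (suc i)) (λ i → P? (suc i))

countFun : (n m : ℕ) (P : (Fin n → Fin m) → Set) → (∀ f → Dec (P f)) → ℕ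
countFun zero    m P P? = if does (P? (λ ())) then 1 else 0
countFun (suc n) m P P? = sumFin m (λ i → countFun n m (λ f → P (i ∷ f)) (λ f → P? (i ∷ f)))
  where
  sumFin : (k : ℕ) → (Fin k → ℕ) → ℕ
  sumFin zero    g = 0
  sumFin (suc k) g = g zero + sumFin k (λ i → g (suc i))

record Graph (n : ℕ) : Set where
  field
    adj    : Fin n → Fin n → Bool
    sym    : ∀ u v → adj u v ≡ adj v u
    irrefl : ∀ v → adj v v ≡ false
open Graph public

Edge : ∀ {n} → Graph n → Fin n → Fin n → Set
Edge G u v = adj G u v ≡ true

-- m-assignments: L(w) is the set of m colours {L w i | i : Fin m},
-- given by an injective enumeration (so |L(w)| = m). Colours are naturals.

record Assignment (n m : ℕ) : Set where
  field
    col : Fin n → Fin m → ℕ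
    col-inj : ∀ w → Injective _≡_ _≡_ (col w)
open Assignment public

-- A proper L-colouring f with f(w) ∈ L(w) is represented by the index
-- c : Fin n → Fin m with f(w) = col L w (c w) (a bijection since col L w is injective).
ProperL : ∀ {n m} → Graph n → Assignment n m → (Fin n → Fin m) → Set
ProperL G L c = ∀ u v → Edge G u v → col L u (c u) ≢ col L v (c v)

properL? : ∀ {n m} (G : Graph n) (L : Assignment n m) c → Dec (ProperL G L c)
properL? G L c = all? λ u → all? λ v →
  (adj G u v Data.Bool.≟ true) →-dec ¬? (col L u (c u) ℕ.≟ col L v (c v))
  where import Data.Bool

P : ∀ {n m} → Graph n → Assignment n m → ℕ
P {n} {m} G L = countFun n m (ProperL G L) (properL? G L)

P-fix : ∀ {n m} → Graph n → Assignment n m → Fin n → Fin m → Fin n → Fin m → ℕ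
P-fix {n} {m} G L u i v j =
  countFun n m (λ c → ProperL G L c × (c u ≡ i × c v ≡ j))
    (λ c → properL? G L c ×-dec ((c u F.≟ i) ×-dec (c v F.≟ j)))

diffSize : ∀ {n m} → Assignment n m → Fin n → Fin n → ℕ
diffSize {n} {m} L u v =
  countFin m (λ i → ∀ j → col L u i ≢ col L v j)
    (λ i → all? λ j → ¬? (col L u i ℕ.≟ col L v j))

-- m-fold DP-covers. The part L(v) of V(H) is {v} × Fin m; the cover graph H
-- is given by its adjacency E u i v j between (u,i) and (v,j).

record DPCover {n : ℕ} (G : Graph n) (m : ℕ) : Set where
  field
    E       : Fin n → Fin m → Fin n → Fin m → Bool
    E-sym   : ∀ u i v j → E u i v j ≡ E v j u i
    -- every edge of H lies between L(u) and L(v) for some edge uv of G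
    -- (in particular none inside a part, as G is loopless)
    E-edge  : ∀ u i v j → E u i v j ≡ true → Edge G u v
    -- edges between L(u) and L(v) form a matching (with E-sym, on both sides)
    E-match : ∀ u i v j j′ → E u i v j ≡ true → E u i v j′ ≡ true → j ≡ j′
open DPCover public

-- proper H-colouring: choose one vertex (v , c v) of each part, forming an independent set
ProperDP : ∀ {n m} {G : Graph n} → DPCover G m → (Fin n → Fin m) → Set
ProperDP H c = ∀ u v → E H u (c u) v (c v) ≡ false

properDP? : ∀ {n m} {G : Graph n} (H : DPCover G m) c → Dec (ProperDP H c)
properDP? H c = all? λ u → all? λ v → E H u (c u) v (c v) Data.Bool.≟ false
  where import Data.Bool

P-DPcover : ∀ {n m} {G : Graph n} → DPCover G m → ℕ
P-DPcover {n} {m} H = countFun n m (ProperDP H) (properDP? H)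

open import Data.Nat using (_≤_)
open import Data.Product using (∃)
IsPDP : ∀ {n} → Graph n → ℕ → ℕ → Set
IsPDP G m k = (∃ λ (H : DPCover G m) → P-DPcover H ≡ k) × (∀ (H : DPCover G m) → k ≤ P-DPcover H)

{-# OPTIONS --safe #-}
-- Take the DP-cover of G that joins equal colours of L, and rewire its matching between L(u)
-- and L(v) into a perfect matching σ that still joins all equal colours. A proper colouring of
-- this cover is a proper L-colouring c with c(v) ≠ σ(c(u)). For each of the d colours
-- x ∈ L(u) \ L(v) the colours x and σ(x) differ, so at least C proper L-colourings send
-- (u, v) to (x, σ(x)); these are not colourings of the cover, and they are disjoint for
-- different x. Hence P(G,L) ≥ P(cover) + Cd ≥ P_DP(G,m) + Cd.
module Submission where

open import Defs hiding (sym)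
open import Data.Nat using (ℕ; zero; suc; _+_; _*_; _≤_; z≤n)
open import Data.Fin using (Fin; zero; suc; punchIn; punchOut; _≟_)
open import Data.Product using (∃; _×_; Σ; _,_; proj₁; proj₂)
open import Relation.Binary.PropositionalEquality
  using (_≡_; _≢_; refl; sym; trans; cong; cong₂; subst; subst₂; module ≡-Reasoning)

open import Data.Bool using (true; if_then_else_)
import Data.Bool as Bool
open import Data.Fin.Properties
  using (any?; all?; ¬Fin0; 0≢1+n; suc-injective; punchIn-injective; punchInᵢ≢i; punchIn-punchOut;
         punchOut-injective; <⇒notInjective)
import Data.Nat as ℕ
open import Data.Nat.Properties
  using (+-*-semiring; +-commutativeSemigroup; ≤-refl; ≤-trans; +-mono-≤; +-monoˡ-≤; +-identityʳ;
         *-identityʳ; *-zeroʳ; n<1+n; module ≤-Reasoning)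
open import Algebra.Properties.Semiring.Sum +-*-semiring using (sum; ∑-distrib-+; *-distribˡ-sum; sum-cong-≗)
open import Algebra.Properties.CommutativeSemigroup +-commutativeSemigroup using (x∙yz≈xz∙y)
open import Data.Empty using (⊥-elim)
open import Data.Sum using (_⊎_; inj₁; inj₂; [_,_])
open import Data.Vec.Functional using (_∷_)
open import Function using (_∘_; mk⇔)
open import Function.Definitions using (Injective)
open import Relation.Nullary using (Dec; yes; no; does; ¬_; contradiction)
open import Relation.Nullary.Decidable using (_×-dec_; _⊎-dec_; ¬?; dec-true; does-⇔)

private variable
  A B : Set

does≡true⇒ : (a? : Dec A) → does a? ≡ true → A
does≡true⇒ (yes a) _ = a

indicator : Dec A → ℕ
indicator a? = if does a? then 1 else 0

indicator-mono : (a? : Dec A) (b? : Dec B) → (A → B) → indicator a? ≤ indicator b?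
indicator-mono (yes _) (yes _) _   = ≤-refl
indicator-mono (yes a) (no ¬b) A⇒B = contradiction (A⇒B a) ¬b
indicator-mono (no _)  _       _   = z≤n

indicator-⊎ : (a? : Dec A) (b? : Dec B) → (A → ¬ B) → indicator a? + indicator b? ≡ indicator (a? ⊎-dec b?)
indicator-⊎ (yes a) (yes b) disjoint = contradiction b (disjoint a)
indicator-⊎ (yes _) (no _)  _        = refl
indicator-⊎ (no _)  (yes _) _        = refl
indicator-⊎ (no _)  (no _)  _        = refl

*-indicator≤ : ∀ C {x} (a? : Dec A) → (A → C ≤ x) → C * indicator a? ≤ x
*-indicator≤ C {x} (yes a) C≤x = subst (_≤ x) (sym (*-identityʳ C)) (C≤x a)
*-indicator≤ C {x} (no _)  _   = subst (_≤ x) (sym (*-zeroʳ C)) z≤n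

sum-mono-≤ : ∀ {k} {g h : Fin k → ℕ} → (∀ i → g i ≤ h i) → sum g ≤ sum h
sum-mono-≤ {zero}  _   = z≤n
sum-mono-≤ {suc k} g≤h = +-mono-≤ (g≤h zero) (sum-mono-≤ (g≤h ∘ suc))

countFin-sum : ∀ k {D : Fin k → Set} (D? : ∀ t → Dec (D t)) → countFin k D D? ≡ sum (λ t → indicator (D? t))
countFin-sum zero    D? = refl
countFin-sum (suc k) D? = cong (indicator (D? zero) +_) (countFin-sum k (D? ∘ suc))

-- `countFun (suc n)` sums with a `where`-bound helper that cannot be named. The meta `sumFinOf`
-- is solved to that helper when `countFun-unfold` is checked by `refl`; the `with`s turn the
-- helper's arguments into variables, as pattern unification requires.
private
  mutual
    sumFinOf : (n m : ℕ) (P : (Fin (suc n) → Fin m) → Set) (P? : ∀ f → Dec (P f)) →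
               (k : ℕ) → (Fin k → ℕ) → ℕ
    sumFinOf = _

    countFun-unfold : ∀ n k P P? →
      countFun (suc n) (suc k) P P? ≡
        countFun n (suc k) (λ f → P (zero ∷ f)) (λ f → P? (zero ∷ f)) +
        sumFinOf n (suc k) P P? k (λ i → countFun n (suc k) (λ f → P (suc i ∷ f)) (λ f → P? (suc i ∷ f)))
    countFun-unfold n k P P?
      with countFun n (suc k) (λ f → P (zero ∷ f)) (λ f → P? (zero ∷ f))
         | (λ i → countFun n (suc k) (λ f → P (suc i ∷ f)) (λ f → P? (suc i ∷ f)))
    ... | _ | _ with suc k
    ... | _ = refl

  sumFinOf-sum : ∀ n m P P? k g → sumFinOf n m P P? k g ≡ sum g
  sumFinOf-sum n m P P? zero    g = refl
  sumFinOf-sum n m P P? (suc k) g = cong (g zero +_) (sumFinOf-sum n m P P? k (g ∘ suc))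

countFun-suc : ∀ n m P P? →
               countFun (suc n) m P P? ≡ sum (λ i → countFun n m (λ f → P (i ∷ f)) (λ f → P? (i ∷ f)))
countFun-suc n zero    P P? = refl
countFun-suc n (suc k) P P? =
  trans (countFun-unfold n k P P?)
        (cong (countFun n (suc k) (λ f → P (zero ∷ f)) (λ f → P? (zero ∷ f)) +_)
              (sumFinOf-sum n (suc k) P P? k _))

countFun-mono : ∀ n {m} {Q R : (Fin n → Fin m) → Set} (Q? : ∀ f → Dec (Q f)) (R? : ∀ f → Dec (R f)) →
                (∀ f → Q f → R f) → countFun n m Q Q? ≤ countFun n m R R?
countFun-mono zero    Q? R? Q⇒R = indicator-mono (Q? _) (R? _) (Q⇒R _)
countFun-mono (suc n) {m} Q? R? Q⇒R =
  subst₂ _≤_ (sym (countFun-suc n m _ Q?)) (sym (countFun-suc n m _ R?))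
    (sum-mono-≤ λ i → countFun-mono n _ _ λ f → Q⇒R (i ∷ f))

countFun-⊎ : ∀ n {m} {A B : (Fin n → Fin m) → Set} (A? : ∀ f → Dec (A f)) (B? : ∀ f → Dec (B f)) →
             (∀ f → A f → ¬ B f) →
             countFun n m A A? + countFun n m B B? ≡ countFun n m (λ f → A f ⊎ B f) (λ f → A? f ⊎-dec B? f)
countFun-⊎ zero    A? B? disjoint = indicator-⊎ (A? _) (B? _) (disjoint _)
countFun-⊎ (suc n) {m} A? B? disjoint = begin
  countFun (suc n) m _ A? + countFun (suc n) m _ B?
    ≡⟨ cong₂ _+_ (countFun-suc n m _ A?) (countFun-suc n m _ B?) ⟩
  sum (fibres A?) + sum (fibres B?)
    ≡⟨ ∑-distrib-+ (fibres A?) (fibres B?) ⟨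
  sum (λ i → fibres A? i + fibres B? i)
    ≡⟨ sum-cong-≗ (λ i → countFun-⊎ n _ _ λ f → disjoint (i ∷ f)) ⟩
  sum (fibres (λ f → A? f ⊎-dec B? f))
    ≡⟨ countFun-suc n m _ (λ f → A? f ⊎-dec B? f) ⟨
  countFun (suc n) m _ (λ f → A? f ⊎-dec B? f)
    ∎
  where
  open ≡-Reasoning
  fibres : {P : (Fin (suc n) → Fin m) → Set} → (∀ f → Dec (P f)) → Fin m → ℕ
  fibres P? i = countFun n m _ (λ f → P? (i ∷ f))

countFun-avoiding+∑≤countFun :
  ∀ n {m k} {R : (Fin n → Fin m) → Set} (R? : ∀ f → Dec (R f))
  {Q : Fin k → (Fin n → Fin m) → Set} (Q? : ∀ t f → Dec (Q t f)) →
  (∀ t f → Q t f → R f) → (∀ {s t} f → Q s f → Q t f → s ≡ t) →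
  countFun n m (λ f → R f × ∀ t → ¬ Q t f) (λ f → R? f ×-dec all? λ t → ¬? (Q? t f))
    + sum (λ t → countFun n m (Q t) (Q? t))
  ≤ countFun n m R R?
countFun-avoiding+∑≤countFun n {m} {zero} R? Q? _ _ = begin
  countFun n m _ (λ f → R? f ×-dec all? λ t → ¬? (Q? t f)) + 0  ≡⟨ +-identityʳ _ ⟩
  countFun n m _ (λ f → R? f ×-dec all? λ t → ¬? (Q? t f))      ≤⟨ countFun-mono n _ R? (λ _ → proj₁) ⟩
  countFun n m _ R?                                             ∎
  where open ≤-Reasoning
countFun-avoiding+∑≤countFun n {m} {suc k} {R} R? {Q} Q? Q⇒R disjoint = begin
  avoidAll + (count₀ + rest)              ≡⟨ x∙yz≈xz∙y avoidAll count₀ rest ⟩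
  (avoidAll + rest) + count₀              ≤⟨ +-monoˡ-≤ count₀ (+-monoˡ-≤ rest avoidAll≤avoidRest) ⟩
  (avoidRest + rest) + count₀             ≤⟨ +-monoˡ-≤ count₀ avoidRest+rest≤R₀ ⟩
  countFun n m _ R₀? + count₀             ≡⟨ countFun-⊎ n R₀? (Q? zero) (λ _ → proj₂) ⟩
  countFun n m _ (λ f → R₀? f ⊎-dec Q? zero f)
                                          ≤⟨ countFun-mono n _ R? (λ f → [ proj₁ , Q⇒R zero f ]) ⟩
  countFun n m R R?                       ∎
  where
  open ≤-Reasoning
  R₀? : ∀ f → Dec (R f × ¬ Q zero f)
  R₀? f = R? f ×-dec ¬? (Q? zero f)
  avoidAll avoidRest count₀ rest : ℕ
  avoidAll  = countFun n m _ (λ f → R? f ×-dec all? λ t → ¬? (Q? t f))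
  avoidRest = countFun n m _ (λ f → R₀? f ×-dec all? λ t → ¬? (Q? (suc t) f))
  count₀    = countFun n m _ (Q? zero)
  rest      = sum (λ t → countFun n m _ (Q? (suc t)))
  avoidAll≤avoidRest : avoidAll ≤ avoidRest
  avoidAll≤avoidRest = countFun-mono n _ _ λ f (r , ¬q) → (r , ¬q zero) , ¬q ∘ suc
  avoidRest+rest≤R₀ : avoidRest + rest ≤ countFun n m _ R₀?
  avoidRest+rest≤R₀ = countFun-avoiding+∑≤countFun n R₀? (Q? ∘ suc)
    (λ t f q → Q⇒R (suc t) f q , λ q₀ → 0≢1+n (disjoint f q₀ q))
    (λ f q q′ → suc-injective (disjoint f q q′))

module MatchingCover {n m} (G : Graph n) (Link : Fin n → Fin m → Fin n → Fin m → Set)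
                     (Link? : ∀ x i y j → Dec (Link x i y j))
                     (Link-sym : ∀ {x i y j} → Link x i y j → Link y j x i)
                     (Link-match : ∀ {x i y j j′} → Link x i y j → Link x i y j′ → j ≡ j′) where

  private
    Linked : Fin n → Fin m → Fin n → Fin m → Set
    Linked x i y j = Edge G x y × Link x i y j

    linked? : ∀ x i y j → Dec (Linked x i y j)
    linked? x i y j = (adj G x y Bool.≟ true) ×-dec Link? x i y j

    linked-sym : ∀ {x i y j} → Linked x i y j → Linked y j x i
    linked-sym {x} {y = y} (xy , link) = trans (Graph.sym G y x) xy , Link-sym link

    linked-witness : ∀ x i y j → does (linked? x i y j) ≡ true → Linked x i y j
    linked-witness x i y j = does≡true⇒ (linked? x i y j)

  cover : DPCover G m
  cover = record
    { E       = λ x i y j → does (linked? x i y j)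
    ; E-sym   = λ x i y j → does-⇔ (mk⇔ linked-sym linked-sym) (linked? x i y j) (linked? y j x i)
    ; E-edge  = λ x i y j → proj₁ ∘ linked-witness x i y j
    ; E-match = λ x i y j j′ e e′ →
        Link-match (proj₂ (linked-witness x i y j e)) (proj₂ (linked-witness x i y j′ e′))
    }

  proper⇒¬link : ∀ c → ProperDP cover c → ∀ x y → Edge G x y → ¬ Link x (c x) y (c y)
  proper⇒¬link c proper x y xy link =
    contradiction (trans (sym (dec-true (linked? x (c x) y (c y)) (xy , link))) (proper x y)) λ ()

module _ {m} {R : Fin (suc m) → Fin (suc m) → Set} (R? : ∀ i j → Dec (R i j))
         (functional : ∀ {i j j′} → R i j → R i j′ → j ≡ j′) where

  unmatched-target : (i₀ : Fin (suc m)) → (∀ j → ¬ R i₀ j) → ∃ λ j → ∀ i → ¬ R i j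
  unmatched-target i₀ i₀-unmatched with any? (λ j → all? λ i → ¬? (R? i j))
  ... | yes free = free
  ... | no ¬free = ⊥-elim (<⇒notInjective (n<1+n m) squeeze-injective)
    where
    preimage : ∀ j → ∃ λ i → R i j
    preimage j with any? (λ i → R? i j)
    ... | yes hit = hit
    ... | no ¬hit = contradiction (j , λ i r → ¬hit (i , r)) ¬free

    preimage≢i₀ : ∀ j → i₀ ≢ proj₁ (preimage j)
    preimage≢i₀ j i₀≡ = i₀-unmatched j (subst (λ i → R i j) (sym i₀≡) (proj₂ (preimage j)))

    squeeze : Fin (suc m) → Fin m
    squeeze j = punchOut (preimage≢i₀ j)

    squeeze-injective : Injective _≡_ _≡_ squeeze
    squeeze-injective {j} {j′} eq =
      functional (proj₂ (preimage j)) (subst (λ i → R i j′) (sym same-preimage) (proj₂ (preimage j′)))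
      where same-preimage = punchOut-injective (preimage≢i₀ j) (preimage≢i₀ j′) eq

  target-of-zero : (∀ {i i′ j} → R i j → R i′ j → i ≡ i′) →
                   Σ (Fin (suc m)) λ j₀ → (∀ {j} → R zero j → j ≡ j₀) × (∀ i → ¬ R (suc i) j₀)
  target-of-zero injective with any? (R? zero)
  ... | yes (j₀ , r₀) = j₀ , (λ r → functional r r₀) , (λ i r → 0≢1+n (injective r₀ r))
  ... | no ¬r₀ with j₀ , unhit ← unmatched-target zero (λ j r → ¬r₀ (j , r)) =
    j₀ , (λ r → contradiction (_ , r) ¬r₀) , (unhit ∘ suc)

extend-partial-injection :
  ∀ m {R : Fin m → Fin m → Set} → (∀ i j → Dec (R i j)) →
  (∀ {i j j′} → R i j → R i j′ → j ≡ j′) → (∀ {i i′ j} → R i j → R i′ j → i ≡ i′) →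
  ∃ λ (σ : Fin m → Fin m) → Injective _≡_ _≡_ σ × (∀ {i j} → R i j → σ i ≡ j)
extend-partial-injection zero _ _ _ = (λ ()) , (λ {i} → contradiction i ¬Fin0) , (λ {i} → contradiction i ¬Fin0)
extend-partial-injection (suc m) {R} R? functional injective
  with j₀ , zero↦j₀ , j₀-unhit ← target-of-zero R? functional injective
  with σ′ , σ′-injective , σ′-extends ← extend-partial-injection m {λ i j → R (suc i) (punchIn j₀ j)}
         (λ i j → R? (suc i) (punchIn j₀ j))
         (λ r r′ → punchIn-injective j₀ _ _ (functional r r′)) (λ r r′ → suc-injective (injective r r′))
  = σ , σ-injective , σ-extends
  where
  σ : Fin (suc m) → Fin (suc m)
  σ zero    = j₀
  σ (suc i) = punchIn j₀ (σ′ i)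

  σ-injective : Injective _≡_ _≡_ σ
  σ-injective {zero}  {zero}  _  = refl
  σ-injective {zero}  {suc i} eq = contradiction (sym eq) (punchInᵢ≢i j₀ (σ′ i))
  σ-injective {suc i} {zero}  eq = contradiction eq (punchInᵢ≢i j₀ (σ′ i))
  σ-injective {suc i} {suc _} eq = cong suc (σ′-injective (punchIn-injective j₀ _ _ eq))

  σ-extends : ∀ {i j} → R i j → σ i ≡ j
  σ-extends {zero}      r = sym (zero↦j₀ r)
  σ-extends {suc i} {j} r = trans (cong (punchIn j₀) (σ′-extends r′)) (punchIn-punchOut j₀≢j)
    where
    j₀≢j : j₀ ≢ j
    j₀≢j refl = j₀-unhit i r
    r′ : R (suc i) (punchIn j₀ (punchOut j₀≢j))
    r′ = subst (R (suc i)) (sym (punchIn-punchOut j₀≢j)) r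

edge⇒≢ : ∀ {n} (G : Graph n) {u v} → Edge G u v → u ≢ v
edge⇒≢ G {u} uv refl = contradiction (trans (sym (irrefl G u)) uv) λ ()

C*diffSize≤∑P-fix : ∀ {n m} (G : Graph n) (L : Assignment n m) (u v : Fin n) (σ : Fin m → Fin m) {C} →
                    (∀ i j → col L u i ≢ col L v j → C ≤ P-fix G L u i v j) →
                    C * diffSize L u v ≤ sum (λ t → P-fix G L u t v (σ t))
C*diffSize≤∑P-fix {m = m} G L u v σ {C} P-fix≥C = begin
  C * diffSize L u v                        ≡⟨ cong (C *_) (countFin-sum m missing?) ⟩
  C * sum (λ t → indicator (missing? t))    ≡⟨ *-distribˡ-sum C (λ t → indicator (missing? t)) ⟩
  sum (λ t → C * indicator (missing? t))
    ≤⟨ sum-mono-≤ (λ t → *-indicator≤ C (missing? t) λ missing → P-fix≥C t (σ t) (missing (σ t))) ⟩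
  sum (λ t → P-fix G L u t v (σ t))         ∎
  where
  open ≤-Reasoning
  missing? : ∀ t → Dec (∀ j → col L u t ≢ col L v j)
  missing? t = all? λ j → ¬? (col L u t ℕ.≟ col L v j)

module Rewired {n m} (G : Graph n) (L : Assignment n m) {u v : Fin n} (uv : Edge G u v)
               (σ : Fin m → Fin m) (σ-injective : Injective _≡_ _≡_ σ)
               (σ-extends : ∀ {i j} → col L u i ≡ col L v j → σ i ≡ j) where

  u≢v : u ≢ v
  u≢v = edge⇒≢ G uv

  Link : Fin n → Fin m → Fin n → Fin m → Set
  Link x i y j = (x ≡ u × y ≡ v × σ i ≡ j) ⊎ (x ≡ v × y ≡ u × σ j ≡ i)
               ⊎ (¬ (x ≡ u × y ≡ v) × ¬ (x ≡ v × y ≡ u) × col L x i ≡ col L y j)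

  link? : ∀ x i y j → Dec (Link x i y j)
  link? x i y j = (x ≟ u ×-dec y ≟ v ×-dec σ i ≟ j) ⊎-dec (x ≟ v ×-dec y ≟ u ×-dec σ j ≟ i)
                ⊎-dec (¬? (x ≟ u ×-dec y ≟ v) ×-dec ¬? (x ≟ v ×-dec y ≟ u) ×-dec col L x i ℕ.≟ col L y j)

  link-sym : ∀ {x i y j} → Link x i y j → Link y j x i
  link-sym (inj₁ (xu , yv , σij))               = inj₂ (inj₁ (yv , xu , σij))
  link-sym (inj₂ (inj₁ (xv , yu , σji)))        = inj₁ (yu , xv , σji)
  link-sym (inj₂ (inj₂ (¬uv , ¬vu , same)))     =
    inj₂ (inj₂ ((λ (yu , xv) → ¬vu (xv , yu)) , (λ (yv , xu) → ¬uv (xu , yv)) , sym same))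

  link-match : ∀ {x i y j j′} → Link x i y j → Link x i y j′ → j ≡ j′
  link-match (inj₁ (_ , _ , σij))   (inj₁ (_ , _ , σij′))         = trans (sym σij) σij′
  link-match (inj₁ (refl , _ , _))  (inj₂ (inj₁ (x≡v , _ , _)))   = contradiction x≡v u≢v
  link-match (inj₁ (xu , yv , _))   (inj₂ (inj₂ (¬uv , _ , _)))   = contradiction (xu , yv) ¬uv
  link-match (inj₂ (inj₁ (refl , _ , _))) (inj₁ (x≡u , _ , _))    = contradiction (sym x≡u) u≢v
  link-match (inj₂ (inj₁ (_ , _ , σji))) (inj₂ (inj₁ (_ , _ , σj′i))) = σ-injective (trans σji (sym σj′i))
  link-match (inj₂ (inj₁ (xv , yu , _))) (inj₂ (inj₂ (_ , ¬vu , _))) = contradiction (xv , yu) ¬vu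
  link-match (inj₂ (inj₂ (¬uv , _ , _))) (inj₁ (xu , yv , _))     = contradiction (xu , yv) ¬uv
  link-match (inj₂ (inj₂ (_ , ¬vu , _))) (inj₂ (inj₁ (xv , yu , _))) = contradiction (xv , yu) ¬vu
  link-match {y = y} (inj₂ (inj₂ (_ , _ , same))) (inj₂ (inj₂ (_ , _ , same′))) =
    col-inj L y (trans (sym same) same′)

  sameColour⇒link : ∀ x i y j → col L x i ≡ col L y j → Link x i y j
  sameColour⇒link x i y j same with x ≟ u ×-dec y ≟ v
  ... | yes (refl , refl) = inj₁ (refl , refl , σ-extends same)
  ... | no ¬uv with x ≟ v ×-dec y ≟ u
  ...   | yes (refl , refl) = inj₂ (inj₁ (refl , refl , σ-extends (sym same)))
  ...   | no ¬vu = inj₂ (inj₂ (¬uv , ¬vu , same))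

  open MatchingCover G Link link? link-sym link-match public

  proper⇒properL : ∀ c → ProperDP cover c → ProperL G L c
  proper⇒properL c proper x y xy = proper⇒¬link c proper x y xy ∘ sameColour⇒link x (c x) y (c y)

  proper⇒avoidsσ : ∀ c → ProperDP cover c → c v ≢ σ (c u)
  proper⇒avoidsσ c proper cv≡σcu = proper⇒¬link c proper u v uv (inj₁ (refl , refl , sym cv≡σcu))

  P-DPcover+C*diffSize≤P : ∀ {C} → (∀ i j → col L u i ≢ col L v j → C ≤ P-fix G L u i v j) →
                           P-DPcover cover + C * diffSize L u v ≤ P G L
  P-DPcover+C*diffSize≤P P-fix≥C =
    ≤-trans (+-mono-≤ (countFun-mono n (properDP? cover) _ proper⇒avoiding)
                      (C*diffSize≤∑P-fix G L u v σ P-fix≥C))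
            (countFun-avoiding+∑≤countFun n (properL? G L) fixing? (λ _ _ → proj₁)
              (λ _ (_ , cu≡s , _) (_ , cu≡t , _) → trans (sym cu≡s) cu≡t))
    where
    fixing? : ∀ t c → Dec (ProperL G L c × c u ≡ t × c v ≡ σ t)
    fixing? t c = properL? G L c ×-dec c u ≟ t ×-dec c v ≟ σ t

    proper⇒avoiding : ∀ c → ProperDP cover c →
                      ProperL G L c × ∀ t → ¬ (ProperL G L c × c u ≡ t × c v ≡ σ t)
    proper⇒avoiding c proper =
      proper⇒properL c proper , λ { t (_ , refl , cv≡σt) → proper⇒avoidsσ c proper cv≡σt }

∃cover-P-DPcover+C*diffSize≤P :
  ∀ {n m} (G : Graph n) (L : Assignment n m) {u v : Fin n} {C} → Edge G u v →
  (∀ i j → col L u i ≢ col L v j → C ≤ P-fix G L u i v j) →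
  ∃ λ (H : DPCover G m) → P-DPcover H + C * diffSize L u v ≤ P G L
∃cover-P-DPcover+C*diffSize≤P {m = m} G L {u} {v} uv P-fix≥C
  with σ , σ-injective , σ-extends ← extend-partial-injection m (λ i j → col L u i ℕ.≟ col L v j)
         (λ same same′ → col-inj L v (trans (sym same) same′))
         (λ same same′ → col-inj L u (trans same (sym same′)))
  = cover , P-DPcover+C*diffSize≤P P-fix≥C
  where open Rewired G L uv σ σ-injective σ-extends

mainTheorem13 : ∀ {n m : ℕ} (G : Graph n) (L : Assignment n m) (u v : Fin n) (d C : ℕ) →
    Edge G u v →
    diffSize L u v ≡ d → 1 ≤ d →
    (∀ i j → col L u i ≢ col L v j → C ≤ P-fix G L u i v j) →
    -- P(G,L) ≥ P_DP(G,m) + C d : for the minimum k = P_DP(G,m) (which exists), and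
    -- equivalently, witnessed by some m-fold cover H with P(H) + C d ≤ P(G,L)
    (∀ k → IsPDP G m k → k + C * d ≤ P G L) ×
    (∃ λ (H : DPCover G m) → P-DPcover H + C * d ≤ P G L)
mainTheorem13 G L u v _ C uv refl _ P-fix≥C
  with H , bound ← ∃cover-P-DPcover+C*diffSize≤P G L uv P-fix≥C
  = (λ k (_ , k≤) → ≤-trans (+-monoˡ-≤ (C * diffSize L u v) (k≤ H)) bound) , H , bound
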